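{- Let $q\in\mathbb{C}$ with $|q|<1$, and let $k,n$ be positive integers with $n$ even. Then $$[2]_q\sum_{l=0}^{n-1}(-1)^{l-1}q^l l^k=q^n\sum_{m=0}^{k-1}\binom{k}{m}E_{m,q}\,n^{k-m}+(q^n-1)E_{k,q}.$$
   Context: Write $[2]_q=1+q$. The $q$-Euler polynomials $E_{n,q}(x)$ are defined by the Taylor expansion at $t=0$ $$\frac{[2]_q}{qe^t+1}e^{xt}=\sum_{n=0}^{\infty}E_{n,q}(x)\frac{t^n}{n!},$$ and the $q$-Euler numbers are $E_{n,q}=E_{n,q}(0)$. -}

module Defs where

open import Level using (_⊔_)
open import Data.Nat using (ℕ; zero; suc)
open import Data.Nat.Combinatorics using (_C_)
open import Algebra.Bundles using (CommutativeRing; Semiring)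

-- Everything is relative to a commutative ring R (standing in for ℂ).
module QEuler {c ℓ} (R : CommutativeRing c ℓ) where
  open CommutativeRing R
  open import Algebra.Definitions.RawSemiring (Semiring.rawSemiring semiring)
    using (_×_; _^_) public

  Σ< : ℕ → (ℕ → Carrier) → Carrier
  Σ< zero    f = 0#
  Σ< (suc n) f = Σ< n f + f n

  ⟦_⟧ : ℕ → Carrier
  ⟦ n ⟧ = n × 1#

  [2]_ : Carrier → Carrier
  [2] q = 1# + q

  -- coefficient of t^n/n! in the constant series [2]_q
  rhsCoeff : Carrier → ℕ → Carrier
  rhsCoeff q zero    = [2] q
  rhsCoeff q (suc n) = 0#

  -- E is the sequence of q-Euler numbers: Σ E n t^n/n! = [2]_q / (q e^t + 1),
  -- i.e. (q e^t + 1) · Σ E n t^n/n! = [2]_q as exponential generating functions.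
  -- Coefficient of t^n/n! on the left: q Σ_{m=0}^{n} (n choose m) E m + E n.
  IsQEulerNumbers : Carrier → (ℕ → Carrier) → Set ℓ
  IsQEulerNumbers q E =
    ∀ n → q * Σ< (suc n) (λ m → (n C m) × E m) + E n ≈ rhsCoeff q n

{-# OPTIONS --safe #-}
-- Put Eₖ(x) := Σₘ (k choose m) Eₘ x^(k-m), the q-Euler polynomial.  Comparing
-- coefficients of ([2]_q / (q eᵗ + 1)) e^{xt} shows q Eₖ(x + 1) + Eₖ(x) = [2]_q xᵏ,
-- so the l-th summand of the left side, multiplied by [2]_q, is G(l + 1) - G(l) for
-- G(l) = (-1)ˡ qˡ Eₖ(l).  The sum telescopes to G(n) - G(0) = qⁿ Eₖ(n) - Eₖ for even n,
-- and splitting off the m = k term of Eₖ(n) gives the right side.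
module Submission where

open import Defs
open import Data.Nat using (ℕ; zero; suc; _≤_; _<_; _∸_)
open import Data.Nat.Combinatorics using (_C_; nCn≡1; k>n⇒nCk≡0; nCk+nC[k+1]≡[n+1]C[k+1])
open import Data.Nat.Divisibility using (_∣_; divides)
open import Data.Nat.Properties using (≤-refl; ≤-pred; m<n⇒m<1+n; n<1+n; n∸n≡0; +-∸-assoc)
import Data.Nat as Nat
open import Data.Maybe using (nothing)
open import Data.Product using (∃)
open import Algebra.Bundles using (CommutativeRing)
import Relation.Binary.PropositionalEquality as ≡
open import Tactic.RingSolver.Core.AlmostCommutativeRing using (fromCommutativeRing)

module _ {c ℓ} (R : CommutativeRing c ℓ) where
  open CommutativeRing R
  open QEuler R
  open import Algebra.Properties.Ring ring using (-1*x≈-x; -‿involutive; -‿distribˡ-*)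
  open import Algebra.Properties.CommutativeSemigroup *-commutativeSemigroup using (x∙yz≈y∙xz)
  open import Algebra.Properties.Semiring.Exp semiring using (^-congʳ)
  open import Algebra.Properties.Semiring.Mult semiring using (×-comm-*)
  open import Algebra.Properties.Monoid.Mult +-monoid using (×-homo-1; ×-homo-+; ×-congʳ; ×-cong)
  open import Relation.Binary.Reasoning.Setoid setoid
  open import Tactic.RingSolver.NonReflective (fromCommutativeRing R (λ _ → nothing))

  Σ<-cong : ∀ n {f g : ℕ → Carrier} → (∀ m → m < n → f m ≈ g m) → Σ< n f ≈ Σ< n g
  Σ<-cong zero    f≈g = refl
  Σ<-cong (suc n) f≈g =
    +-cong (Σ<-cong n (λ m m<n → f≈g m (m<n⇒m<1+n m<n))) (f≈g n ≤-refl)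

  Σ<-+ : ∀ n (f g : ℕ → Carrier) → Σ< n (λ m → f m + g m) ≈ Σ< n f + Σ< n g
  Σ<-+ zero    f g = sym (+-identityʳ 0#)
  Σ<-+ (suc n) f g = trans (+-cong (Σ<-+ n f g) refl) (interchange _ _ _ _)
    where
    interchange : ∀ a b c d → (a + b) + (c + d) ≈ (a + c) + (b + d)
    interchange = solve 4 (λ a b c d → ((a ⊕ b) ⊕ (c ⊕ d)) ⊜ ((a ⊕ c) ⊕ (b ⊕ d))) refl

  *-distribˡ-Σ< : ∀ n z (f : ℕ → Carrier) → z * Σ< n f ≈ Σ< n (λ m → z * f m)
  *-distribˡ-Σ< zero    z f = zeroʳ z
  *-distribˡ-Σ< (suc n) z f = trans (distribˡ z _ _) (+-cong (*-distribˡ-Σ< n z f) refl)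

  Σ<-suc : ∀ n (f : ℕ → Carrier) → Σ< (suc n) f ≈ f 0 + Σ< n (λ m → f (suc m))
  Σ<-suc zero    f = trans (+-identityˡ _) (sym (+-identityʳ _))
  Σ<-suc (suc n) f = trans (+-cong (Σ<-suc n f) refl) (+-assoc _ _ _)

  Σ<-telescope : ∀ n (g : ℕ → Carrier) → Σ< n (λ l → g (suc l) - g l) ≈ g n - g 0
  Σ<-telescope zero    g = sym (-‿inverseʳ (g 0))
  Σ<-telescope (suc n) g =
    trans (+-cong (Σ<-telescope n g) refl) (cancel (g (suc n)) (g n) (g 0))
    where
    cancel : ∀ a b c → (b - c) + (a - b) ≈ a - c
    cancel a b c = begin
      (b - c) + (a - b) ≈⟨ regroup a b (- b) (- c) ⟩
      (a - c) + (b - b) ≈⟨ +-cong refl (-‿inverseʳ b) ⟩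
      (a - c) + 0#      ≈⟨ +-identityʳ _ ⟩
      a - c             ∎
      where
      regroup : ∀ a b b′ c′ → (b + c′) + (a + b′) ≈ (a + c′) + (b + b′)
      regroup = solve 4 (λ a b b′ c′ → ((b ⊕ c′) ⊕ (a ⊕ b′)) ⊜ ((a ⊕ c′) ⊕ (b ⊕ b′))) refl

  1#^n≈1# : ∀ n → 1# ^ n ≈ 1#
  1#^n≈1# zero    = refl
  1#^n≈1# (suc n) = trans (*-identityˡ _) (1#^n≈1# n)

  -1#^even≈1# : ∀ n → 2 ∣ n → (- 1#) ^ n ≈ 1#
  -1#^even≈1# n (divides j n≡j*2) = trans (^-congʳ (- 1#) n≡j*2) (square-power j)
    where
    square-power : ∀ j → (- 1#) ^ (j Nat.* 2) ≈ 1#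
    square-power zero    = refl
    square-power (suc j) = begin
      - 1# * (- 1# * (- 1#) ^ (j Nat.* 2)) ≈⟨ trans (-1*x≈-x _) (-‿cong (-1*x≈-x _)) ⟩
      - - ((- 1#) ^ (j Nat.* 2))           ≈⟨ -‿involutive _ ⟩
      (- 1#) ^ (j Nat.* 2)                 ≈⟨ square-power j ⟩
      1#                                   ∎

  -- appell k a z = Σₘ (k choose m) aₘ z^(k-m) (appell≈binomialSum); defined through
  -- Pascal's rule so that every identity below is a plain induction on k.
  appell : ℕ → (ℕ → Carrier) → Carrier → Carrier
  appell zero    a z = a 0
  appell (suc k) a z = z * appell k a z + appell k (λ j → a (suc j)) z

  appell-cong : ∀ k {a b : ℕ → Carrier} z → (∀ j → a j ≈ b j) → appell k a z ≈ appell k b z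
  appell-cong zero    z a≈b = a≈b 0
  appell-cong (suc k) z a≈b =
    +-cong (*-cong refl (appell-cong k z a≈b)) (appell-cong k z (λ j → a≈b (suc j)))

  appell-congʳ : ∀ k (a : ℕ → Carrier) {z w} → z ≈ w → appell k a z ≈ appell k a w
  appell-congʳ zero    a z≈w = refl
  appell-congʳ (suc k) a z≈w =
    +-cong (*-cong z≈w (appell-congʳ k a z≈w)) (appell-congʳ k _ z≈w)

  appell-linear : ∀ k y (b c : ℕ → Carrier) z →
    appell k (λ j → y * b j + c j) z ≈ y * appell k b z + appell k c z
  appell-linear zero    y b c z = refl
  appell-linear (suc k) y b c z = begin
    z * appell k (λ j → y * b j + c j) z + appell k (λ j → y * b (suc j) + c (suc j)) z
      ≈⟨ +-cong (*-cong refl (appell-linear k y b c z)) (appell-linear k y _ _ z) ⟩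
    z * (y * u + v) + (y * u′ + v′)
      ≈⟨ regroup z y u v u′ v′ ⟩
    y * (z * u + u′) + (z * v + v′) ∎
    where
    u  = appell k b z
    v  = appell k c z
    u′ = appell k (λ j → b (suc j)) z
    v′ = appell k (λ j → c (suc j)) z
    regroup : ∀ z y u v u′ v′ → z * (y * u + v) + (y * u′ + v′) ≈ y * (z * u + u′) + (z * v + v′)
    regroup = solve 6 (λ z y u v u′ v′ →
      (z ⊗ (y ⊗ u ⊕ v) ⊕ (y ⊗ u′ ⊕ v′)) ⊜ (y ⊗ (z ⊗ u ⊕ u′) ⊕ (z ⊗ v ⊕ v′))) refl

  appell-translate : ∀ k (a : ℕ → Carrier) x y → appell k a (x + y) ≈ appell k (λ j → appell j a y) x
  appell-translate zero    a x y = refl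
  appell-translate (suc k) a x y = begin
    (x + y) * appell k a (x + y) + appell k (λ j → a (suc j)) (x + y)
      ≈⟨ +-cong (*-cong refl (appell-translate k a x y)) (appell-translate k _ x y) ⟩
    (x + y) * appell k b x + appell k b′ x
      ≈⟨ trans (+-cong (distribʳ _ x y) refl) (+-assoc _ _ _) ⟩
    x * appell k b x + (y * appell k b x + appell k b′ x)
      ≈⟨ +-cong refl (sym (appell-linear k y b b′ x)) ⟩
    x * appell k b x + appell k (λ j → y * b j + b′ j) x ∎
    where
    b b′ : ℕ → Carrier
    b  j = appell j a y
    b′ j = appell j (λ i → a (suc i)) y

  appell-at-0# : ∀ k a → appell k a 0# ≈ a k
  appell-at-0# zero    a = refl
  appell-at-0# (suc k) a = begin
    0# * appell k a 0# + appell k (λ j → a (suc j)) 0# ≈⟨ +-cong (zeroˡ _) (appell-at-0# k _) ⟩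
    0# + a (suc k)                                       ≈⟨ +-identityˡ _ ⟩
    a (suc k)                                            ∎

  appell-zeros : ∀ k z → appell k (λ _ → 0#) z ≈ 0#
  appell-zeros zero    z = refl
  appell-zeros (suc k) z = begin
    z * appell k (λ _ → 0#) z + appell k (λ _ → 0#) z ≈⟨ +-cong (*-cong refl (appell-zeros k z)) (appell-zeros k z) ⟩
    z * 0# + 0#                                       ≈⟨ trans (+-identityʳ _) (zeroʳ z) ⟩
    0#                                                ∎

  appell-rhsCoeff : ∀ k q z → appell k (rhsCoeff q) z ≈ [2] q * z ^ k
  appell-rhsCoeff zero    q z = sym (*-identityʳ _)
  appell-rhsCoeff (suc k) q z = begin
    z * appell k (rhsCoeff q) z + appell k (λ _ → 0#) z
      ≈⟨ +-cong (*-cong refl (appell-rhsCoeff k q z)) (appell-zeros k z) ⟩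
    z * ([2] q * z ^ k) + 0#
      ≈⟨ trans (+-identityʳ _) (x∙yz≈y∙xz z ([2] q) (z ^ k)) ⟩
    [2] q * (z * z ^ k) ∎

  binomialSum : ℕ → (ℕ → Carrier) → Carrier → Carrier
  binomialSum k a z = Σ< (suc k) (λ m → (k C m) × (a m * z ^ (k ∸ m)))

  *-binomialSum : ∀ k a z →
    z * binomialSum k a z
      ≈ 1 × (a 0 * z ^ suc k) + Σ< (suc k) (λ m → (k C suc m) × (a (suc m) * z ^ (k ∸ m)))
  *-binomialSum k a z = begin
    z * binomialSum k a z
      ≈⟨ *-distribˡ-Σ< (suc k) z _ ⟩
    Σ< (suc k) (λ m → z * ((k C m) × (a m * z ^ (k ∸ m))))
      ≈⟨ Σ<-cong (suc k) (λ m m<1+k → raise m (≤-pred m<1+k)) ⟩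
    Σ< (suc k) (λ m → (k C m) × (a m * z ^ (suc k ∸ m)))
      ≈⟨ sym (trans (+-cong refl (×-cong (k>n⇒nCk≡0 (n<1+n k)) refl)) (+-identityʳ _)) ⟩
    Σ< (suc (suc k)) (λ m → (k C m) × (a m * z ^ (suc k ∸ m)))
      ≈⟨ Σ<-suc (suc k) _ ⟩
    1 × (a 0 * z ^ suc k) + Σ< (suc k) (λ m → (k C suc m) × (a (suc m) * z ^ (k ∸ m))) ∎
    where
    raise : ∀ m → m ≤ k → z * ((k C m) × (a m * z ^ (k ∸ m))) ≈ (k C m) × (a m * z ^ (suc k ∸ m))
    raise m m≤k = begin
      z * ((k C m) × (a m * z ^ (k ∸ m))) ≈⟨ ×-comm-* (k C m) z _ ⟩
      (k C m) × (z * (a m * z ^ (k ∸ m))) ≈⟨ ×-congʳ (k C m) (x∙yz≈y∙xz z (a m) _) ⟩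
      (k C m) × (a m * z ^ suc (k ∸ m))   ≈⟨ ×-congʳ (k C m) (*-cong refl (^-congʳ z (≡.sym (+-∸-assoc 1 m≤k)))) ⟩
      (k C m) × (a m * z ^ (suc k ∸ m))   ∎

  binomialSum-suc : ∀ k a z →
    binomialSum (suc k) a z ≈ z * binomialSum k a z + binomialSum k (λ j → a (suc j)) z
  binomialSum-suc k a z = begin
    binomialSum (suc k) a z
      ≈⟨ Σ<-suc (suc k) _ ⟩
    t₀ + Σ< (suc k) (λ m → (suc k C suc m) × h m)
      ≈⟨ +-cong refl (Σ<-cong (suc k) (λ m _ → pascal m)) ⟩
    t₀ + Σ< (suc k) (λ m → (k C m) × h m + (k C suc m) × h m)
      ≈⟨ +-cong refl (Σ<-+ (suc k) _ _) ⟩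
    t₀ + (binomialSum k (λ j → a (suc j)) z + Σ< (suc k) (λ m → (k C suc m) × h m))
      ≈⟨ regroup t₀ _ _ ⟩
    (t₀ + Σ< (suc k) (λ m → (k C suc m) × h m)) + binomialSum k (λ j → a (suc j)) z
      ≈⟨ +-cong (sym (*-binomialSum k a z)) refl ⟩
    z * binomialSum k a z + binomialSum k (λ j → a (suc j)) z ∎
    where
    t₀ = 1 × (a 0 * z ^ suc k)
    h : ℕ → Carrier
    h m = a (suc m) * z ^ (k ∸ m)
    pascal : ∀ m → (suc k C suc m) × h m ≈ (k C m) × h m + (k C suc m) × h m
    pascal m = trans (×-cong (≡.sym (nCk+nC[k+1]≡[n+1]C[k+1] k m)) refl) (×-homo-+ (h m) (k C m) (k C suc m))
    regroup : ∀ x y w → x + (y + w) ≈ (x + w) + y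
    regroup = solve 3 (λ x y w → (x ⊕ (y ⊕ w)) ⊜ ((x ⊕ w) ⊕ y)) refl

  appell≈binomialSum : ∀ k a z → appell k a z ≈ binomialSum k a z
  appell≈binomialSum zero    a z = sym (trans (+-identityˡ _) (trans (+-identityʳ _) (*-identityʳ _)))
  appell≈binomialSum (suc k) a z = begin
    z * appell k a z + appell k (λ j → a (suc j)) z
      ≈⟨ +-cong (*-cong refl (appell≈binomialSum k a z)) (appell≈binomialSum k _ z) ⟩
    z * binomialSum k a z + binomialSum k (λ j → a (suc j)) z
      ≈⟨ sym (binomialSum-suc k a z) ⟩
    binomialSum (suc k) a z ∎

  appell-at-1# : ∀ k a → appell k a 1# ≈ Σ< (suc k) (λ m → (k C m) × a m)
  appell-at-1# k a = trans (appell≈binomialSum k a 1#) (Σ<-cong (suc k) (λ m _ →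
    ×-congʳ (k C m) (trans (*-cong refl (1#^n≈1# (k ∸ m))) (*-identityʳ _))))

  appell-split-last : ∀ k a z → appell k a z ≈ Σ< k (λ m → (k C m) × (a m * z ^ (k ∸ m))) + a k
  appell-split-last k a z = trans (appell≈binomialSum k a z) (+-cong refl (begin
    (k C k) × (a k * z ^ (k ∸ k)) ≈⟨ ×-cong (nCn≡1 k) (*-cong refl (^-congʳ z (n∸n≡0 k))) ⟩
    1 × (a k * 1#)               ≈⟨ trans (×-homo-1 _) (*-identityʳ _) ⟩
    a k                          ∎))

  module _ (q : Carrier) (E : ℕ → Carrier) (isQEuler : IsQEulerNumbers q E) (k : ℕ) where

    qEuler-difference : ∀ x → q * appell k E (1# + x) + appell k E x ≈ [2] q * x ^ k
    qEuler-difference x = begin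
      q * appell k E (1# + x) + appell k E x
        ≈⟨ +-cong (*-cong refl (trans (appell-congʳ k E (+-comm 1# x)) (appell-translate k E x 1#))) refl ⟩
      q * appell k (λ j → appell j E 1#) x + appell k E x
        ≈⟨ sym (appell-linear k q _ E x) ⟩
      appell k (λ j → q * appell j E 1# + E j) x
        ≈⟨ appell-cong k x (λ j → trans (+-cong (*-cong refl (appell-at-1# j E)) refl) (isQEuler j)) ⟩
      appell k (rhsCoeff q) x
        ≈⟨ appell-rhsCoeff k q x ⟩
      [2] q * x ^ k ∎

    signedEuler : ℕ → Carrier
    signedEuler l = (- 1#) ^ l * q ^ l * appell k E ⟦ l ⟧

    [2]*summand≈Δ-signedEuler : ∀ l →
      [2] q * (- ((- 1#) ^ l) * q ^ l * ⟦ l ⟧ ^ k) ≈ signedEuler (suc l) - signedEuler l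
    [2]*summand≈Δ-signedEuler l = begin
      [2] q * (- s * r * ⟦ l ⟧ ^ k)
        ≈⟨ x∙yz≈y∙xz ([2] q) (- s * r) (⟦ l ⟧ ^ k) ⟩
      - s * r * ([2] q * ⟦ l ⟧ ^ k)
        ≈⟨ *-cong refl (sym (qEuler-difference ⟦ l ⟧)) ⟩
      - s * r * (q * appell k E ⟦ suc l ⟧ + appell k E ⟦ l ⟧)
        ≈⟨ trans (distribˡ _ _ _) (+-cong (rearrange (- s) r q _) refl) ⟩
      - s * (q * r) * appell k E ⟦ suc l ⟧ + - s * r * appell k E ⟦ l ⟧
        ≈⟨ +-cong (*-cong (*-cong (sym (-1*x≈-x s)) refl) refl) (sym (-‿assoc s r _)) ⟩
      signedEuler (suc l) - signedEuler l ∎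
      where
      s = (- 1#) ^ l
      r = q ^ l
      rearrange : ∀ s r q p → s * r * (q * p) ≈ s * (q * r) * p
      rearrange s r q p =
        trans (sym (*-assoc (s * r) q p)) (*-cong (trans (*-assoc s r q) (*-cong refl (*-comm r q))) refl)
      -‿assoc : ∀ s r p → - (s * r * p) ≈ - s * r * p
      -‿assoc s r p = trans (-‿distribˡ-* (s * r) p) (*-cong (-‿distribˡ-* s r) refl)

    [2]*alternatingSum-even : ∀ n → 2 ∣ n →
      [2] q * Σ< n (λ l → - ((- 1#) ^ l) * q ^ l * ⟦ l ⟧ ^ k)
        ≈ q ^ n * Σ< k (λ m → (k C m) × (E m * ⟦ n ⟧ ^ (k ∸ m))) + (q ^ n - 1#) * E k
    [2]*alternatingSum-even n 2∣n = begin
      [2] q * Σ< n (λ l → - ((- 1#) ^ l) * q ^ l * ⟦ l ⟧ ^ k)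
        ≈⟨ *-distribˡ-Σ< n ([2] q) _ ⟩
      Σ< n (λ l → [2] q * (- ((- 1#) ^ l) * q ^ l * ⟦ l ⟧ ^ k))
        ≈⟨ Σ<-cong n (λ l _ → [2]*summand≈Δ-signedEuler l) ⟩
      Σ< n (λ l → signedEuler (suc l) - signedEuler l)
        ≈⟨ Σ<-telescope n signedEuler ⟩
      (- 1#) ^ n * q ^ n * appell k E ⟦ n ⟧ - (1# * 1#) * appell k E 0#
        ≈⟨ +-cong (*-cong (trans (*-cong (-1#^even≈1# n 2∣n) refl) (*-identityˡ _)) (appell-split-last k E ⟦ n ⟧))
                  (-‿cong (trans (*-cong (*-identityˡ 1#) refl) (trans (*-identityˡ _) (appell-at-0# k E)))) ⟩
      q ^ n * (S + E k) - E k
        ≈⟨ regroup (q ^ n) S (E k) ⟩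
      q ^ n * S + (q ^ n * E k - E k)
        ≈⟨ +-cong refl (trans (+-cong refl (sym (-1*x≈-x (E k)))) (sym (distribʳ (E k) (q ^ n) (- 1#)))) ⟩
      q ^ n * S + (q ^ n - 1#) * E k ∎
      where
      S = Σ< k (λ m → (k C m) × (E m * ⟦ n ⟧ ^ (k ∸ m)))
      regroup : ∀ r s e → r * (s + e) - e ≈ r * s + (r * e - e)
      regroup = solve 3 (λ r s e → (r ⊗ (s ⊕ e) ⊕ ⊝ e) ⊜ (r ⊗ s ⊕ (r ⊗ e ⊕ ⊝ e))) refl

theorem6 : ∀ {c ℓ} (R : CommutativeRing c ℓ) →
    let open CommutativeRing R
        open QEuler R
    in (q : Carrier) → ∃ (λ u → [2] q * u ≈ 1#) →
       (E : ℕ → Carrier) → IsQEulerNumbers q E →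
       (k n : ℕ) → 1 ≤ k → 1 ≤ n → 2 ∣ n →
       [2] q * Σ< n (λ l → - ((- 1#) ^ l) * (q ^ l) * (⟦ l ⟧ ^ k))
         ≈ (q ^ n) * Σ< k (λ m → (k C m) × (E m * (⟦ n ⟧ ^ (k ∸ m))))
           + ((q ^ n) - 1#) * E k
theorem6 R q _ E isQEuler k n _ _ 2∣n = [2]*alternatingSum-even R q E isQEuler k n 2∣n
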